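{- Let $\{f_j(q)\}_{j\ge 0}$ be a self-positive sequence of basic palindromic polynomials. Let $n,m\ge0$, and suppose $f(q)$ is $\mathcal{F}_n$-positive and $g(q)$ is $\mathcal{F}_m$-positive. Then $f(q)g(q)$ is $\mathcal{F}_{n+m}$-positive.
   Context: For a nonzero real polynomial $f(q)=a_rq^r+\cdots+a_sq^s$ with $a_r\neq 0$, $a_s\neq 0$, its darga is $r+s$, and $f$ is palindromic if $a_{r+i}=a_{s-i}$ for all $i$. A sequence $\{f_j(q)\}_{j\ge0}$ of real polynomials is a sequence of basic palindromic polynomials if each $f_j(q)$ is a palindromic polynomial of darga $j$ with nonzero constant term. For $n\ge0$, $\mathcal{F}_n=\{q^jf_{n-2j}(q): j=0,1,\ldots,\lfloor n/2\rfloor\}$, which is a basis of the space of palindromic polynomials of darga $n$. A polynomial is $\mathcal{F}_n$-positive if it equals $\sum_{j=0}^{\lfloor n/2\rfloor}c_jq^jf_{n-2j}(q)$ with all $c_j\ge0$. The sequence $\{f_j\}$ is self-positive if $f_i(q)f_j(q)$ is $\mathcal{F}_{i+j}$-positive for all $i,j\ge0$. -}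

module Defs where

open import Level using (_⊔_)
open import Data.Nat as ℕ using (ℕ; zero; suc; _∸_; ⌊_/2⌋)
open import Data.Product using (Σ; ∃; _×_; _,_)
open import Relation.Nullary using (¬_)
open import Relation.Binary.PropositionalEquality using (_≡_)
open import Relation.Binary.Core using (Rel)
open import Relation.Binary.Structures using (IsTotalOrder)
open import Algebra.Bundles using (CommutativeRing)

-- An ordered commutative ring (the real numbers ℝ are an instance).
-- agda-stdlib has neither ℝ nor ordered rings, so we work over an
-- arbitrary ordered commutative ring: total order compatible with + and
-- with products of nonnegative elements nonnegative.
record OrderedCommRing (c ℓ₁ ℓ₂ : Level.Level) : Set (Level.suc (c ⊔ ℓ₁ ⊔ ℓ₂)) where
  field
    commutativeRing : CommutativeRing c ℓ₁
  open CommutativeRing commutativeRing public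
  field
    _≤_          : Rel Carrier ℓ₂
    isTotalOrder : IsTotalOrder _≈_ _≤_
    +-monoˡ-≤    : ∀ {x y} z → x ≤ y → (x + z) ≤ (y + z)
    *-nonneg     : ∀ {x y} → 0# ≤ x → 0# ≤ y → 0# ≤ (x * y)

module OR {c ℓ₁ ℓ₂} (R : OrderedCommRing c ℓ₁ ℓ₂) where
  open OrderedCommRing R

  -- A polynomial is represented by its coefficient function:
  -- p k is the coefficient of q^k.  Polynomial equality = coefficientwise ≈.
  Poly : Set c
  Poly = ℕ → Carrier

  _≋_ : Poly → Poly → Set ℓ₁
  p ≋ r = ∀ k → p k ≈ r k

  sumBelow : ℕ → (ℕ → Carrier) → Carrier
  sumBelow zero    a = 0#
  sumBelow (suc n) a = sumBelow n a + a n

  _*ₚ_ : Poly → Poly → Poly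
  (p *ₚ r) k = sumBelow (suc k) (λ i → p i * r (k ∸ i))

  shift : ℕ → Poly → Poly
  shift zero    p k       = p k
  shift (suc j) p zero    = 0#
  shift (suc j) p (suc k) = shift j p k

  IsPalindromicOfDarga : ℕ → Poly → Set (ℓ₁)
  IsPalindromicOfDarga n p =
    Σ ℕ λ r → Σ ℕ λ s →
      (r ℕ.+ s ≡ n) × (r ℕ.≤ s) ×
      (¬ (p r ≈ 0#)) × (¬ (p s ≈ 0#)) ×
      (∀ i → i ℕ.< r → p i ≈ 0#) ×
      (∀ i → s ℕ.< i → p i ≈ 0#) ×
      (∀ i → i ℕ.≤ s ∸ r → p (r ℕ.+ i) ≈ p (s ∸ i))

  IsBasicPalindromicSeq : (ℕ → Poly) → Set ℓ₁
  IsBasicPalindromicSeq fs =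
    ∀ j → IsPalindromicOfDarga j (fs j) × (¬ (fs j 0 ≈ 0#))

  FPositive : (ℕ → Poly) → ℕ → Poly → Set (c ⊔ ℓ₁ ⊔ ℓ₂)
  FPositive fs n p =
    Σ (ℕ → Carrier) λ cs →
      (∀ j → 0# ≤ cs j) ×
      (∀ k → p k ≈ sumBelow (suc ⌊ n /2⌋)
                      (λ j → cs j * shift j (fs (n ∸ (2 ℕ.* j))) k))

  SelfPositive : (ℕ → Poly) → Set (c ⊔ ℓ₁ ⊔ ℓ₂)
  SelfPositive fs = ∀ i j → FPositive fs (i ℕ.+ j) (fs i *ₚ fs j)

module Submission where

-- Over an ordered commutative ring, the F_N-positive polynomials form a
-- convex cone: they are closed under coefficientwise equality, sums and
-- nonnegative scalings, hence under nonnegative combinations.  Multiplying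
-- by q^a moves the cone of darga N into the cone of darga N + 2a, since
-- q^a · q^j f_{N-2j} = q^(a+j) f_{(N+2a) - 2(a+j)}.
--
-- The polynomial product is bilinear and commutes with multiplication by
-- q^a in either factor.  So if f = Σ_a c_a q^a f_{n-2a} with c_a ≥ 0, then
-- f g is the nonnegative combination Σ_a c_a q^a (f_{n-2a} g), and it
-- suffices to show each f_i g is F_{i+m}-positive.  Expanding g in the same
-- way reduces this to the products q^b f_i f_{m-2b}, which are positive by
-- self-positivity and the shifting lemma.

open import Defs
open import Level using (Level)
open import Data.Nat using (ℕ; zero; suc; _∸_; ⌊_/2⌋; z≤n; s≤s)
import Data.Nat as ℕ
open import Data.Nat.Properties
  using (*-suc; m<n⇒m<1+n; n<1+n; m<1+n⇒m≤n; +-∸-assoc; +-∸-comm; n∸n≡0;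
         m+[n∸m]≡n; ≤-trans; m≤n+m; m≤m+n)
open import Data.Product using (_,_)
open import Relation.Binary.PropositionalEquality using (_≡_; cong; subst)
import Relation.Binary.PropositionalEquality as ≡
open import Relation.Binary.Structures using (IsTotalOrder)
import Algebra.Properties.CommutativeSemigroup as CommSemigroupProperties

module Positivity {c ℓ₁ ℓ₂} (R : OrderedCommRing c ℓ₁ ℓ₂) where
  open OrderedCommRing R renaming (_≤_ to _≤ᴿ_)
  open OR R
  open import Relation.Binary.Reasoning.Setoid setoid
  open CommSemigroupProperties +-commutativeSemigroup using (interchange)
  open CommSemigroupProperties *-commutativeSemigroup using (x∙yz≈y∙xz)
  private module Order = IsTotalOrder isTotalOrder

  sum-cong : ∀ n {a b : ℕ → Carrier} →
             (∀ i → i ℕ.< n → a i ≈ b i) → sumBelow n a ≈ sumBelow n b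
  sum-cong zero    a≈b = refl
  sum-cong (suc n) a≈b =
    +-cong (sum-cong n (λ i i<n → a≈b i (m<n⇒m<1+n i<n))) (a≈b n (n<1+n n))

  sum-cong-∀ : ∀ n {a b : ℕ → Carrier} →
               (∀ i → a i ≈ b i) → sumBelow n a ≈ sumBelow n b
  sum-cong-∀ n a≈b = sum-cong n (λ i _ → a≈b i)

  sum-zeros : ∀ n {a : ℕ → Carrier} → (∀ i → a i ≈ 0#) → sumBelow n a ≈ 0#
  sum-zeros zero    a≈0 = refl
  sum-zeros (suc n) a≈0 = trans (+-cong (sum-zeros n a≈0) (a≈0 n)) (+-identityʳ 0#)

  sum-+ : ∀ n (a b : ℕ → Carrier) →
          sumBelow n (λ i → a i + b i) ≈ sumBelow n a + sumBelow n b
  sum-+ zero    a b = sym (+-identityʳ 0#)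
  sum-+ (suc n) a b = trans (+-cong (sum-+ n a b) refl) (interchange _ _ _ _)

  sum-scaleˡ : ∀ x n (a : ℕ → Carrier) →
               x * sumBelow n a ≈ sumBelow n (λ i → x * a i)
  sum-scaleˡ x zero    a = zeroʳ x
  sum-scaleˡ x (suc n) a = trans (distribˡ x _ _) (+-cong (sum-scaleˡ x n a) refl)

  sum-scaleʳ : ∀ x n (a : ℕ → Carrier) →
               sumBelow n a * x ≈ sumBelow n (λ i → a i * x)
  sum-scaleʳ x zero    a = zeroˡ x
  sum-scaleʳ x (suc n) a = trans (distribʳ x _ _) (+-cong (sum-scaleʳ x n a) refl)

  sum-head : ∀ n (a : ℕ → Carrier) →
             sumBelow (suc n) a ≈ a 0 + sumBelow n (λ i → a (suc i))
  sum-head zero    a = trans (+-identityˡ _) (sym (+-identityʳ _))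
  sum-head (suc n) a = trans (+-cong (sum-head n a) refl) (+-assoc _ _ _)

  sum-swap : ∀ n L (t : ℕ → ℕ → Carrier) →
             sumBelow n (λ i → sumBelow L (t i)) ≈ sumBelow L (λ a → sumBelow n (λ i → t i a))
  sum-swap n zero    t = sum-zeros n (λ _ → refl)
  sum-swap n (suc L) t = trans (sum-+ n _ _) (+-cong (sum-swap n L t) refl)

  sum-swap-scaled : ∀ n L (cs : ℕ → Carrier) (t : ℕ → ℕ → Carrier) →
                    sumBelow n (λ i → sumBelow L (λ a → cs a * t a i))
                      ≈ sumBelow L (λ a → cs a * sumBelow n (t a))
  sum-swap-scaled n L cs t =
    trans (sum-swap n L _) (sum-cong-∀ L (λ a → sym (sum-scaleˡ (cs a) n (t a))))

  combination : ℕ → (ℕ → Carrier) → (ℕ → Poly) → Poly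
  combination L cs Q k = sumBelow L (λ a → cs a * Q a k)

  *ₚ-congˡ : ∀ {p p′} r → p ≋ p′ → (p *ₚ r) ≋ (p′ *ₚ r)
  *ₚ-congˡ r p≋p′ k = sum-cong-∀ (suc k) (λ i → *-cong (p≋p′ i) refl)

  *ₚ-congʳ : ∀ p {r r′} → r ≋ r′ → (p *ₚ r) ≋ (p *ₚ r′)
  *ₚ-congʳ p r≋r′ k = sum-cong-∀ (suc k) (λ i → *-cong refl (r≋r′ (k ∸ i)))

  combination-*ₚˡ : ∀ L cs Q r →
                    (combination L cs Q *ₚ r) ≋ combination L cs (λ a → Q a *ₚ r)
  combination-*ₚˡ L cs Q r k = begin
      sumBelow (suc k) (λ i → combination L cs Q i * r (k ∸ i))
    ≈⟨ sum-cong-∀ (suc k) (λ i → trans (sum-scaleʳ (r (k ∸ i)) L _)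
                                       (sum-cong-∀ L (λ a → *-assoc _ _ _))) ⟩
      sumBelow (suc k) (λ i → sumBelow L (λ a → cs a * (Q a i * r (k ∸ i))))
    ≈⟨ sum-swap-scaled (suc k) L cs _ ⟩
      combination L cs (λ a → Q a *ₚ r) k
    ∎

  combination-*ₚʳ : ∀ L cs Q p →
                    (p *ₚ combination L cs Q) ≋ combination L cs (λ a → p *ₚ Q a)
  combination-*ₚʳ L cs Q p k = begin
      sumBelow (suc k) (λ i → p i * combination L cs Q (k ∸ i))
    ≈⟨ sum-cong-∀ (suc k) (λ i → trans (sum-scaleˡ (p i) L _)
                                       (sum-cong-∀ L (λ a → x∙yz≈y∙xz _ _ _))) ⟩
      sumBelow (suc k) (λ i → sumBelow L (λ a → cs a * (p i * Q a (k ∸ i))))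
    ≈⟨ sum-swap-scaled (suc k) L cs _ ⟩
      combination L cs (λ a → p *ₚ Q a) k
    ∎

  shift-*ₚˡ : ∀ a p r → (shift a p *ₚ r) ≋ shift a (p *ₚ r)
  shift-*ₚˡ zero    p r k       = refl
  shift-*ₚˡ (suc a) p r zero    = trans (+-identityˡ _) (zeroˡ _)
  shift-*ₚˡ (suc a) p r (suc k) = begin
      (shift (suc a) p *ₚ r) (suc k)
    ≈⟨ sum-head (suc k) _ ⟩
      0# * r (suc k) + (shift a p *ₚ r) k
    ≈⟨ trans (+-cong (zeroˡ _) refl) (+-identityˡ _) ⟩
      (shift a p *ₚ r) k
    ≈⟨ shift-*ₚˡ a p r k ⟩
      shift a (p *ₚ r) k
    ∎

  shift-*ₚʳ : ∀ b p r → (p *ₚ shift b r) ≋ shift b (p *ₚ r)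
  shift-*ₚʳ zero    p r k       = refl
  shift-*ₚʳ (suc b) p r zero    = trans (+-identityˡ _) (zeroʳ _)
  shift-*ₚʳ (suc b) p r (suc k) = begin
      sumBelow (suc k) (λ i → p i * shift (suc b) r (suc k ∸ i))
        + p (suc k) * shift (suc b) r (k ∸ k)
    ≈⟨ +-cong (sum-cong (suc k) lower-terms) top-term ⟩
      (p *ₚ shift b r) k + 0#
    ≈⟨ +-identityʳ _ ⟩
      (p *ₚ shift b r) k
    ≈⟨ shift-*ₚʳ b p r k ⟩
      shift b (p *ₚ r) k
    ∎
    where
    -- for i ≤ k the index (k+1) - i is the successor of k - i
    lower-terms : ∀ i → i ℕ.< suc k →
                  p i * shift (suc b) r (suc k ∸ i) ≈ p i * shift b r (k ∸ i)
    lower-terms i i<1+k = *-cong refl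
      (reflexive (cong (shift (suc b) r) (+-∸-assoc 1 (m<1+n⇒m≤n i<1+k))))
    -- the term i = k+1 meets the vanishing constant coefficient of q^(b+1) r
    top-term : p (suc k) * shift (suc b) r (k ∸ k) ≈ 0#
    top-term = trans (*-cong refl (reflexive (cong (shift (suc b) r) (n∸n≡0 k))))
                     (zeroʳ _)

  shift-cong : ∀ a {p p′} → p ≋ p′ → shift a p ≋ shift a p′
  shift-cong zero    p≋p′ k       = p≋p′ k
  shift-cong (suc a) p≋p′ zero    = refl
  shift-cong (suc a) p≋p′ (suc k) = shift-cong a p≋p′ k

  shift-suc : ∀ a p → shift 1 (shift a p) ≋ shift (suc a) p
  shift-suc a p zero    = refl
  shift-suc a p (suc k) = refl

  shift1-combination : ∀ L cs Q →
                       shift 1 (combination L cs Q) ≋ combination L cs (λ a → shift 1 (Q a))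
  shift1-combination L cs Q zero    = sym (sum-zeros L (λ a → zeroʳ (cs a)))
  shift1-combination L cs Q (suc k) = refl

  nonneg-+ : ∀ {x y} → 0# ≤ᴿ x → 0# ≤ᴿ y → 0# ≤ᴿ (x + y)
  nonneg-+ {x} {y} 0≤x 0≤y =
    Order.trans (Order.reflexive (sym (+-identityˡ 0#)))
    (Order.trans (+-monoˡ-≤ 0# 0≤x)
    (Order.trans (Order.reflexive (+-comm x 0#))
    (Order.trans (+-monoˡ-≤ x 0≤y) (Order.reflexive (+-comm y x)))))

  -- b ≤ ⌊N/2⌋ exactly when q^b f_{N-2b} is a genuine element of F_N.
  double-≤ : ∀ N b → b ℕ.≤ ⌊ N /2⌋ → 2 ℕ.* b ℕ.≤ N
  double-≤ N             zero    _           = z≤n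
  double-≤ (suc (suc N)) (suc b) (s≤s b≤N/2) =
    subst (ℕ._≤ suc (suc N)) (≡.sym (*-suc 2 b)) (s≤s (s≤s (double-≤ N b b≤N/2)))

  module Cone (fs : ℕ → Poly) where

    basis : ℕ → ℕ → Poly
    basis N j = shift j (fs (N ∸ 2 ℕ.* j))

    positive-resp : ∀ {N p p′} → p ≋ p′ → FPositive fs N p → FPositive fs N p′
    positive-resp p≋p′ (cs , cs≥0 , p≈) = cs , cs≥0 , (λ k → trans (sym (p≋p′ k)) (p≈ k))

    positive-zero : ∀ N → FPositive fs N (λ _ → 0#)
    positive-zero N =
      (λ _ → 0#) , (λ _ → Order.refl) ,
      (λ k → sym (sum-zeros (suc ⌊ N /2⌋) (λ j → zeroˡ (basis N j k))))

    positive-+ : ∀ {N p p′} → FPositive fs N p → FPositive fs N p′ →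
                 FPositive fs N (λ k → p k + p′ k)
    positive-+ {N} (cs , cs≥0 , p≈) (cs′ , cs′≥0 , p′≈) =
      (λ j → cs j + cs′ j) , (λ j → nonneg-+ (cs≥0 j) (cs′≥0 j)) ,
      (λ k → trans (+-cong (p≈ k) (p′≈ k))
        (trans (sym (sum-+ (suc ⌊ N /2⌋) _ _))
               (sum-cong-∀ (suc ⌊ N /2⌋) (λ j → sym (distribʳ (basis N j k) _ _)))))

    positive-scale : ∀ {N p} x → 0# ≤ᴿ x → FPositive fs N p →
                     FPositive fs N (λ k → x * p k)
    positive-scale {N} x 0≤x (cs , cs≥0 , p≈) =
      (λ j → x * cs j) , (λ j → *-nonneg 0≤x (cs≥0 j)) ,
      (λ k → trans (*-cong refl (p≈ k))
        (trans (sum-scaleˡ x (suc ⌊ N /2⌋) _)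
               (sum-cong-∀ (suc ⌊ N /2⌋) (λ j → sym (*-assoc _ _ _)))))

    positive-combination : ∀ {N} L cs Q → (∀ a → 0# ≤ᴿ cs a) →
                           (∀ a → a ℕ.< L → FPositive fs N (Q a)) →
                           FPositive fs N (combination L cs Q)
    positive-combination {N} zero    cs Q cs≥0 Q+ = positive-zero N
    positive-combination     (suc L) cs Q cs≥0 Q+ =
      positive-+ (positive-combination L cs Q cs≥0 (λ a a<L → Q+ a (m<n⇒m<1+n a<L)))
                 (positive-scale (cs L) (cs≥0 L) (Q+ L (n<1+n L)))

    basis-step : ∀ N j → basis (2 ℕ.+ N) (suc j) ≋ shift 1 (basis N j)
    basis-step N j zero    = refl
    basis-step N j (suc k) =
      reflexive (cong (λ t → shift j (fs t) k) (cong (suc (suc N) ∸_) (*-suc 2 j)))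

    -- Multiplication by q maps the cone of darga N into that of darga N+2,
    -- moving every coefficient one slot up.
    positive-shift1 : ∀ {N p} → FPositive fs N p → FPositive fs (2 ℕ.+ N) (shift 1 p)
    positive-shift1 {N} {p} (cs , cs≥0 , p≈) = raised , raised≥0 , expansion
      where
      raised : ℕ → Carrier
      raised zero    = 0#
      raised (suc j) = cs j
      raised≥0 : ∀ j → 0# ≤ᴿ raised j
      raised≥0 zero    = Order.refl
      raised≥0 (suc j) = cs≥0 j
      L = suc ⌊ N /2⌋
      expansion : ∀ k → shift 1 p k ≈ combination (suc L) raised (basis (2 ℕ.+ N)) k
      expansion k = sym (begin
          combination (suc L) raised (basis (2 ℕ.+ N)) k
        ≈⟨ sum-head L _ ⟩
          0# * basis (2 ℕ.+ N) 0 k + combination L cs (λ j → basis (2 ℕ.+ N) (suc j)) k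
        ≈⟨ trans (+-cong (zeroˡ _) refl) (+-identityˡ _) ⟩
          combination L cs (λ j → basis (2 ℕ.+ N) (suc j)) k
        ≈⟨ sum-cong-∀ L (λ j → *-cong refl (basis-step N j k)) ⟩
          combination L cs (λ j → shift 1 (basis N j)) k
        ≈⟨ sym (shift1-combination L cs (basis N) k) ⟩
          shift 1 (combination L cs (basis N)) k
        ≈⟨ sym (shift-cong 1 p≈ k) ⟩
          shift 1 p k
        ∎)

    positive-shift : ∀ {N p} a → FPositive fs N p → FPositive fs (2 ℕ.* a ℕ.+ N) (shift a p)
    positive-shift         zero    p+ = p+
    positive-shift {N} {p} (suc a) p+ =
      subst (λ M → FPositive fs M (shift (suc a) p)) (cong (ℕ._+ N) (≡.sym (*-suc 2 a)))
            (positive-resp (shift-suc a p) (positive-shift1 (positive-shift a p+)))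

    -- The form in which shifting is used: into the cone of darga M from M - 2a.
    positive-shift-into : ∀ {M p} a → 2 ℕ.* a ℕ.≤ M →
                          FPositive fs (M ∸ 2 ℕ.* a) p → FPositive fs M (shift a p)
    positive-shift-into {M} {p} a 2a≤M p+ =
      subst (λ M′ → FPositive fs M′ (shift a p)) (m+[n∸m]≡n 2a≤M) (positive-shift a p+)

    positive-*ₚʳ : ∀ {N M p h} → FPositive fs N h →
                   (∀ b → b ℕ.≤ ⌊ N /2⌋ → FPositive fs M (p *ₚ basis N b)) →
                   FPositive fs M (p *ₚ h)
    positive-*ₚʳ {N} {M} {p} (cs , cs≥0 , h≈) basis+ =
      positive-resp (λ k → sym (trans (*ₚ-congʳ p h≈ k)
                                      (combination-*ₚʳ (suc ⌊ N /2⌋) cs (basis N) p k)))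
        (positive-combination (suc ⌊ N /2⌋) cs _ cs≥0 (λ b b<L → basis+ b (m<1+n⇒m≤n b<L)))

    positive-*ₚˡ : ∀ {N M h r} → FPositive fs N h →
                   (∀ a → a ℕ.≤ ⌊ N /2⌋ → FPositive fs M (basis N a *ₚ r)) →
                   FPositive fs M (h *ₚ r)
    positive-*ₚˡ {N} {M} {r = r} (cs , cs≥0 , h≈) basis+ =
      positive-resp (λ k → sym (trans (*ₚ-congˡ r h≈ k)
                                      (combination-*ₚˡ (suc ⌊ N /2⌋) cs (basis N) r k)))
        (positive-combination (suc ⌊ N /2⌋) cs _ cs≥0 (λ a a<L → basis+ a (m<1+n⇒m≤n a<L)))

    -- For a self-positive sequence, f_i times an F_N-positive polynomial is
    -- F_(i+N)-positive: f_i q^b f_{N-2b} = q^b (f_i f_{N-2b}).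
    module _ (self-positive : SelfPositive fs) where

      fs-*ₚ-positive : ∀ i {N h} → FPositive fs N h → FPositive fs (i ℕ.+ N) (fs i *ₚ h)
      fs-*ₚ-positive i {N} h+ = positive-*ₚʳ h+ (λ b b≤N/2 →
        let 2b≤N = double-≤ N b b≤N/2 in
        positive-resp (λ k → sym (shift-*ₚʳ b (fs i) _ k))
          (positive-shift-into b (≤-trans 2b≤N (m≤n+m N i))
            (subst (λ M → FPositive fs M (fs i *ₚ fs (N ∸ 2 ℕ.* b)))
                   (≡.sym (+-∸-assoc i 2b≤N))
                   (self-positive i (N ∸ 2 ℕ.* b)))))

      -- The cone condition is multiplicative: F_n-positive times
      -- F_m-positive is F_(n+m)-positive, via q^a f_{n-2a} g = q^a (f_{n-2a} g).
      positive-*ₚ : ∀ {n m f g} → FPositive fs n f → FPositive fs m g →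
                    FPositive fs (n ℕ.+ m) (f *ₚ g)
      positive-*ₚ {n} {m} {g = g} f+ g+ = positive-*ₚˡ {r = g} f+ (λ a a≤n/2 →
        let 2a≤n = double-≤ n a a≤n/2 in
        positive-resp (λ k → sym (shift-*ₚˡ a _ g k))
          (positive-shift-into a (≤-trans 2a≤n (m≤m+n n m))
            (subst (λ M → FPositive fs M (fs (n ∸ 2 ℕ.* a) *ₚ g))
                   (≡.sym (+-∸-comm m 2a≤n))
                   (fs-*ₚ-positive (n ∸ 2 ℕ.* a) g+))))

-- ℕ addition is opened only here: inside Positivity, _+_ is the ring's.
open import Data.Nat using (_+_)

proposition3p4 : ∀ {c ℓ₁ ℓ₂ : Level} (R : OrderedCommRing c ℓ₁ ℓ₂) →
    let open OR R in
    (fs : ℕ → Poly) → IsBasicPalindromicSeq fs → SelfPositive fs →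
    (n m : ℕ) (f g : Poly) → FPositive fs n f → FPositive fs m g →
    FPositive fs (n + m) (f *ₚ g)
proposition3p4 R fs _ self-positive n m f g f+ g+ =
  Positivity.Cone.positive-*ₚ R fs self-positive f+ g+
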